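{- Let $G$ be a connected graph with $n$ vertices and $m\ge1$ edges, and let $s\neq t$ be vertices of $G$. Let $P$ be the probability that $s$ and $t$ are disconnected when each edge of $G$ is removed independently with probability $1/2$. For a positive integer $k$, construct $G'$ from $G$ by adding a new edge $(s,t)$, a new simple path from $s$ to a new vertex $s'$ consisting of $k$ new vertices, and a new simple path from $t$ to a new vertex $t'$ consisting of $k$ new vertices; every edge of $G'$ independently gets weight $1$ with probability $1/2$ and weight $0$ with probability $1/2$. Let $D$ be the (random) diameter of $G'$. Then, for $k=\Theta(m)$ chosen sufficiently large (i.e., $k\ge Km$ for a suitable absolute constant $K$), $P\le 2(\mathbb{E}[D]-k)<P+2^{ -m}$.
   Context: The diameter of a weighted graph is $\max_{u,v}\mathrm{dist}(u,v)$, where $\mathrm{dist}(u,v)$ is the minimum total weight of a path between $u$ and $v$. -}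

module Defs where

open import Data.Nat as ℕ using (ℕ; zero; suc; _+_; _*_; _^_)
open import Data.Nat.Properties using (m^n≢0)
open import Data.Fin using (Fin; zero; suc; _↑ˡ_; _↑ʳ_; inject₁)
open import Data.Nat.ListAction using (sum)
open import Data.Vec using (Vec; []; _∷_; lookup; tabulate; map; _++_)
open import Data.Bool using (Bool; true; false; if_then_else_)
open import Data.List as L using (List)
open import Data.Product using (_×_; _,_; ∃-syntax; proj₁; proj₂)
open import Data.Sum using (_⊎_)
open import Data.Integer using (+_)
open import Data.Rational using (ℚ; _/_)
open import Relation.Binary.PropositionalEquality using (_≡_; _≢_)
open import Relation.Nullary using (Dec; ¬_)
open import Relation.Nullary.Decidable using (isYes)

-- A (multi)graph on vertex set Fin N with m edges, the i-th edge being
-- lookup E i (an unordered pair, stored as an ordered pair).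
Edges : ℕ → ℕ → Set
Edges N m = Vec (Fin N × Fin N) m

SameEdge : ∀ {N} → Fin N × Fin N → Fin N × Fin N → Set
SameEdge (a , b) (c , d) = ((a ≡ c) × (b ≡ d)) ⊎ ((a ≡ d) × (b ≡ c))

Simple : ∀ {N m} → Edges N m → Set
Simple {N} {m} E =
  (∀ (i : Fin m) → proj₁ (lookup E i) ≢ proj₂ (lookup E i)) ×
  (∀ (i j : Fin m) → SameEdge (lookup E i) (lookup E j) → i ≡ j)

Joins : ∀ {N m} → Edges N m → Fin m → Fin N → Fin N → Set
Joins E i u v = (lookup E i ≡ (u , v)) ⊎ (lookup E i ≡ (v , u))

data Reach {N m} (E : Edges N m) (keep : Fin m → Bool) (u : Fin N) : Fin N → Set where
  here : Reach E keep u u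
  step : ∀ {v x} (i : Fin m) → Reach E keep u v → keep i ≡ true → Joins E i v x →
         Reach E keep u x

Connected : ∀ {N m} → Edges N m → Set
Connected {N} E = ∀ (u v : Fin N) → Reach E (λ _ → true) u v

data Walk {N m} (E : Edges N m) (wt : Fin m → ℕ) (u : Fin N) : Fin N → ℕ → Set where
  here : Walk E wt u u 0
  step : ∀ {v x d} (i : Fin m) → Walk E wt u v d → Joins E i v x →
         Walk E wt u x (d + wt i)

IsDist : ∀ {N m} → Edges N m → (Fin m → ℕ) → Fin N → Fin N → ℕ → Set
IsDist E wt u v d = Walk E wt u v d × (∀ d' → Walk E wt u v d' → d ℕ.≤ d')

IsDiameter : ∀ {N m} → Edges N m → (Fin m → ℕ) → ℕ → Set
IsDiameter {N} E wt D =
  (∃[ u ] ∃[ v ] IsDist E wt u v D) ×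
  (∀ (u v : Fin N) d → IsDist E wt u v d → d ℕ.≤ D)

-- all 2^m bit vectors of length m (outcomes of m fair coins)
allVecs : (m : ℕ) → List (Vec Bool m)
allVecs zero = [] L.∷ L.[]
allVecs (suc m) = L.map (true ∷_) (allVecs m) L.++ L.map (false ∷_) (allVecs m)

weightOf : ∀ {m} → Vec Bool m → Fin m → ℕ
weightOf w i = if lookup w i then 1 else 0

dyadic : ℕ → ℕ → ℚ
dyadic a e = _/_ (+ a) (2 ^ e) {{m^n≢0 2 e}}

-- Construction of G' (vertex set Fin (n + k + k)):
--  old vertices : inject+ k (inject+ k v)
--  s-path new vertices a_1..a_k : inject+ k (raise n j)   (a_k = s')
--  t-path new vertices b_1..b_k : raise (n + k) j        (b_k = t')
old : ∀ {n} k → Fin n → Fin (n + k + k)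
old k v = (v ↑ˡ k) ↑ˡ k

newS : ∀ n k → Fin k → Fin (n + k + k)
newS n k j = (n ↑ʳ j) ↑ˡ k

newT : ∀ n k → Fin k → Fin (n + k + k)
newT n k j = (n + k) ↑ʳ j

prevOn : ∀ {N k} → Fin N → (Fin k → Fin N) → Fin k → Fin N
prevOn s f zero = s
prevOn s f (suc j) = f (inject₁ j)

pathEdges : ∀ {N} k → Fin N → (Fin k → Fin N) → Edges N k
pathEdges k s f = tabulate (λ j → prevOn s f j , f j)

G'edges : ∀ {n m} → Edges n m → Fin n → Fin n → (k : ℕ) → Edges (n + k + k) (m + suc (k + k))
G'edges {n} E s t k =
  map (λ e → old k (proj₁ e) , old k (proj₂ e)) E ++
  ((old k s , old k t) ∷ (pathEdges k (old k s) (newS n k) ++ pathEdges k (old k t) (newT n k)))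

-- P = Pr[s,t disconnected when each edge removed independently w.p. 1/2];
-- keep-vector b : edge i survives iff lookup b i ≡ true.
disconnProb : ∀ {n m} (E : Edges n m) (s t : Fin n) →
  (∀ (b : Vec Bool m) → Dec (Reach E (lookup b) s t)) → ℚ
disconnProb {n} {m} E s t dec =
  dyadic (sum (L.map (λ b → if isYes (dec b) then 0 else 1) (allVecs m))) m

expectation : ∀ M → (Vec Bool M → ℕ) → ℚ
expectation M D = dyadic (sum (L.map D (allVecs M))) M

module Submission where

-- Write a weighting of G' as w = g ++ (c ∷ (a ++ b)): g weighs the edges of G,
-- c the new edge st, a and b the two new paths.  Put X = ones a, Y = ones b and
-- let Z = 1 iff c = 1 and s, t are not joined by weight-0 edges of G.
--   * Lower bound D w ≥ X + Y + Z: a potential on the vertices that changes by at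
--     most the weight across each edge is 0 at s' and X + Y + Z at t'.
--   * Upper bound D w ≤ X + Y + Z + 2m·([X < m] + [Y < m]): vertices of G are
--     within distance m (a walk that repeats no edge has at most m edges), the
--     vertices of each new path are within the weight of that path, and so every
--     pair is within the bound; detours through G cost ≤ 2m ≤ X + Y when X, Y ≥ m.
-- Averaging over all 2^M weightings, E[X + Y + Z] = k + P/2 (Z has mean P/2
-- because complementing g preserves the uniform measure), while the tail bound
-- #{a : ones a < m} ≤ 3^m (4/3)^k makes the mean excess smaller than 2^(-m-1)
-- once k ≥ 10m.  Multiplied by 2^M, both claims become inequalities between
-- natural numbers, which are then transported to ℚ; the theorem holds with K = 10.

open import Defs
open import Data.Nat using (ℕ; zero; suc; _+_; _*_; _^_; _∸_; _≤_; _<_; z≤n; s≤s; _<ᵇ_)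
open import Data.Nat.Properties
open import Data.Nat.ListAction using (sum)
open import Data.Nat.ListAction.Properties using (sum-++)
open import Data.Nat.Tactic.RingSolver using (solve-∀)
import Data.Integer as ℤ
import Data.Integer.Properties as ℤP
import Data.Integer.Tactic.RingSolver as ℤSolver
open import Data.Rational as ℚ using (ℚ; 1ℚ; toℚᵘ)
import Data.Rational.Properties as ℚP
open import Data.Rational.Unnormalised as ℚᵘ using (ℚᵘ; mkℚᵘ; *≡*; *≤*; *<*)
import Data.Rational.Unnormalised.Properties as ℚᵘP
open import Data.Rational.Solver using (module +-*-Solver)
open import Data.Fin using (Fin; zero; suc; _↑ˡ_; _↑ʳ_; toℕ; inject₁; fromℕ; splitAt)
import Data.Fin.Properties as FinP
open import Data.Vec as V using (Vec; []; _∷_; _++_; lookup)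
import Data.Vec.Properties as VP
open import Data.List as L using (List; length)
import Data.List.Properties as LP
open import Data.List.Relation.Unary.All as All using (All)
open import Data.List.Relation.Unary.All.Properties using (¬Any⇒All¬)
open import Data.List.Relation.Unary.Any using (here; there; any?)
open import Data.List.Relation.Unary.AllPairs as AllPairs using (_∷_)
open import Data.List.Relation.Unary.Unique.Propositional using (Unique)
open import Data.List.Membership.Propositional using (_∈_)
open import Data.List.Membership.Propositional.Properties using (∈-lookup)
open import Data.Bool using (Bool; true; false; not; if_then_else_)
open import Data.Product as Product using (Σ; _×_; _,_; proj₁; proj₂; ∃-syntax)
open import Data.Sum using (_⊎_; inj₁; inj₂; [_,_]′; map₁; map₂)
open import Data.Empty using (⊥-elim)
open import Relation.Binary.PropositionalEquality 
open import Relation.Nullary using (Dec; yes; no)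
open import Relation.Nullary.Decidable using (isYes)

bit : Bool → ℕ
bit b = if b then 1 else 0

bit≤1 : ∀ b → bit b ≤ 1
bit≤1 true = s≤s z≤n
bit≤1 false = z≤n

ones : ∀ {k} → Vec Bool k → ℕ
ones [] = 0
ones (x ∷ v) = bit x + ones v

sumVecs : (p : ℕ) → (Vec Bool p → ℕ) → ℕ
sumVecs zero F = F []
sumVecs (suc p) F = sumVecs p (λ v → F (true ∷ v)) + sumVecs p (λ v → F (false ∷ v))

sum-allVecs : ∀ p (F : Vec Bool p → ℕ) → sum (L.map F (allVecs p)) ≡ sumVecs p F
sum-allVecs zero F = +-identityʳ (F [])
sum-allVecs (suc p) F = begin
    sum (L.map F (L.map (true ∷_) A L.++ L.map (false ∷_) A))
  ≡⟨ cong sum (LP.map-++ F (L.map (true ∷_) A) (L.map (false ∷_) A)) ⟩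
    sum (L.map F (L.map (true ∷_) A) L.++ L.map F (L.map (false ∷_) A))
  ≡⟨ sum-++ (L.map F (L.map (true ∷_) A)) _ ⟩
    sum (L.map F (L.map (true ∷_) A)) + sum (L.map F (L.map (false ∷_) A))
  ≡⟨ cong₂ _+_ (cong sum (sym (LP.map-∘ A))) (cong sum (sym (LP.map-∘ A))) ⟩
    sum (L.map (λ v → F (true ∷ v)) A) + sum (L.map (λ v → F (false ∷ v)) A)
  ≡⟨ cong₂ _+_ (sum-allVecs p _) (sum-allVecs p _) ⟩
    sumVecs (suc p) F ∎
  where open ≡-Reasoning
        A = allVecs p

sumVecs-cong : ∀ p {F G : Vec Bool p → ℕ} → (∀ v → F v ≡ G v) → sumVecs p F ≡ sumVecs p G
sumVecs-cong zero e = e []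
sumVecs-cong (suc p) e =
  cong₂ _+_ (sumVecs-cong p (λ v → e (true ∷ v))) (sumVecs-cong p (λ v → e (false ∷ v)))

sumVecs-mono : ∀ p {F G : Vec Bool p → ℕ} → (∀ v → F v ≤ G v) → sumVecs p F ≤ sumVecs p G
sumVecs-mono zero e = e []
sumVecs-mono (suc p) e =
  +-mono-≤ (sumVecs-mono p (λ v → e (true ∷ v))) (sumVecs-mono p (λ v → e (false ∷ v)))

+-interchange : ∀ a b c d → (a + b) + (c + d) ≡ (a + c) + (b + d)
+-interchange = solve-∀

+-swapʳ : ∀ a b c → a + b + c ≡ a + c + b
+-swapʳ = solve-∀

sumVecs-+ : ∀ p (F G : Vec Bool p → ℕ) → sumVecs p (λ v → F v + G v) ≡ sumVecs p F + sumVecs p G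
sumVecs-+ zero F G = refl
sumVecs-+ (suc p) F G = trans
  (cong₂ _+_ (sumVecs-+ p (λ v → F (true ∷ v)) (λ v → G (true ∷ v)))
             (sumVecs-+ p (λ v → F (false ∷ v)) (λ v → G (false ∷ v))))
  (+-interchange (sumVecs p (λ v → F (true ∷ v))) (sumVecs p (λ v → G (true ∷ v)))
                 (sumVecs p (λ v → F (false ∷ v))) (sumVecs p (λ v → G (false ∷ v))))

sumVecs-const : ∀ p c → sumVecs p (λ _ → c) ≡ c * 2 ^ p
sumVecs-const zero c = sym (*-identityʳ c)
sumVecs-const (suc p) c = trans (cong₂ _+_ (sumVecs-const p c) (sumVecs-const p c)) (double c (2 ^ p))
  where double : ∀ a b → a * b + a * b ≡ a * (2 * b)
        double = solve-∀

sumVecs-*ˡ : ∀ p c (F : Vec Bool p → ℕ) → sumVecs p (λ v → c * F v) ≡ c * sumVecs p F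
sumVecs-*ˡ zero c F = refl
sumVecs-*ˡ (suc p) c F =
  trans (cong₂ _+_ (sumVecs-*ˡ p c _) (sumVecs-*ˡ p c _)) (sym (*-distribˡ-+ c _ _))

sumVecs-*ʳ : ∀ p c (F : Vec Bool p → ℕ) → sumVecs p (λ v → F v * c) ≡ sumVecs p F * c
sumVecs-*ʳ p c F =
  trans (sumVecs-cong p (λ v → *-comm (F v) c)) (trans (sumVecs-*ˡ p c F) (*-comm c (sumVecs p F)))

sumVecs-++ : ∀ p q (F : Vec Bool (p + q) → ℕ) →
  sumVecs (p + q) F ≡ sumVecs p (λ u → sumVecs q (λ v → F (u ++ v)))
sumVecs-++ zero q F = refl
sumVecs-++ (suc p) q F = cong₂ _+_ (sumVecs-++ p q _) (sumVecs-++ p q _)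

sumVecs-not : ∀ p (F : Vec Bool p → ℕ) → sumVecs p (λ v → F (V.map not v)) ≡ sumVecs p F
sumVecs-not zero F = refl
sumVecs-not (suc p) F =
  trans (cong₂ _+_ (sumVecs-not p (λ v → F (false ∷ v))) (sumVecs-not p (λ v → F (true ∷ v))))
        (+-comm (sumVecs p (λ v → F (false ∷ v))) (sumVecs p (λ v → F (true ∷ v))))

sumVecs-ones : ∀ k → 2 * sumVecs k ones ≡ k * 2 ^ k
sumVecs-ones zero = refl
sumVecs-ones (suc k) = begin
    2 * (sumVecs k (λ v → 1 + ones v) + sumVecs k ones)
  ≡⟨ cong (λ z → 2 * (z + sumVecs k ones))
          (trans (sumVecs-+ k (λ _ → 1) ones) (cong (_+ sumVecs k ones) (sumVecs-const k 1))) ⟩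
    2 * ((1 * 2 ^ k + sumVecs k ones) + sumVecs k ones)
  ≡⟨ regroup (2 ^ k) (sumVecs k ones) ⟩
    2 * (1 * 2 ^ k) + 2 * (2 * sumVecs k ones)
  ≡⟨ cong (λ z → 2 * (1 * 2 ^ k) + 2 * z) (sumVecs-ones k) ⟩
    2 * (1 * 2 ^ k) + 2 * (k * 2 ^ k)
  ≡⟨ collect k (2 ^ k) ⟩
    suc k * 2 ^ suc k ∎
  where open ≡-Reasoning
        regroup : ∀ a b → 2 * ((1 * a + b) + b) ≡ 2 * (1 * a) + 2 * (2 * b)
        regroup = solve-∀
        collect : ∀ k a → 2 * (1 * a) + 2 * (k * a) ≡ suc k * (2 * a)
        collect = solve-∀

sumVecs-separable : ∀ k (f f' : Vec Bool k → ℕ) z →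
  sumVecs k (λ a → sumVecs k (λ b → f a + f' b + z))
    ≡ sumVecs k f * 2 ^ k + (sumVecs k f' + z * 2 ^ k) * 2 ^ k
sumVecs-separable k f f' z = begin
    sumVecs k (λ a → sumVecs k (λ b → f a + f' b + z))
  ≡⟨ sumVecs-cong k inner ⟩
    sumVecs k (λ a → f a * 2 ^ k + (sumVecs k f' + z * 2 ^ k))
  ≡⟨ sumVecs-+ k (λ a → f a * 2 ^ k) (λ _ → sumVecs k f' + z * 2 ^ k) ⟩
    sumVecs k (λ a → f a * 2 ^ k) + sumVecs k (λ _ → sumVecs k f' + z * 2 ^ k)
  ≡⟨ cong₂ _+_ (sumVecs-*ʳ k (2 ^ k) f) (sumVecs-const k _) ⟩
    sumVecs k f * 2 ^ k + (sumVecs k f' + z * 2 ^ k) * 2 ^ k ∎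
  where
  open ≡-Reasoning
  inner : ∀ a → sumVecs k (λ b → f a + f' b + z) ≡ f a * 2 ^ k + (sumVecs k f' + z * 2 ^ k)
  inner a = begin
      sumVecs k (λ b → f a + f' b + z)
    ≡⟨ sumVecs-+ k (λ b → f a + f' b) (λ _ → z) ⟩
      sumVecs k (λ b → f a + f' b) + sumVecs k (λ _ → z)
    ≡⟨ cong₂ _+_ (sumVecs-+ k (λ _ → f a) f') (sumVecs-const k z) ⟩
      sumVecs k (λ _ → f a) + sumVecs k f' + z * 2 ^ k
    ≡⟨ cong (λ u → u + sumVecs k f' + z * 2 ^ k) (sumVecs-const k (f a)) ⟩
      f a * 2 ^ k + sumVecs k f' + z * 2 ^ k
    ≡⟨ +-assoc (f a * 2 ^ k) (sumVecs k f') (z * 2 ^ k) ⟩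
      f a * 2 ^ k + (sumVecs k f' + z * 2 ^ k) ∎

below : ℕ → ℕ → ℕ
below c j = if c <ᵇ j then 1 else 0

below≤1 : ∀ c j → below c j ≤ 1
below≤1 c j = bit≤1 (c <ᵇ j)

below-cases : ∀ c j → (j ≤ c × below c j ≡ 0) ⊎ (below c j ≡ 1)
below-cases c zero = inj₁ (z≤n , refl)
below-cases zero (suc j) = inj₂ refl
below-cases (suc c) (suc j) with below-cases c j
... | inj₁ (j≤c , e) = inj₁ (s≤s j≤c , e)
... | inj₂ e = inj₂ e

fewOnes : ℕ → ℕ → ℕ
fewOnes k j = sumVecs k (λ a → below (ones a) j)

-- Chernoff-type tail bound: #{a ∈ {0,1}^k : ones a < j} ≤ 3^j (4/3)^k.
-- Splitting on the first coin gives fewOnes (k+1) (j+1) = fewOnes k j + fewOnes k (j+1),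
-- and 3·(3^j + 3^(j+1)) = 3^(j+1)·4.
fewOnes-bound : ∀ k j → 3 ^ k * fewOnes k j ≤ 3 ^ j * 4 ^ k
fewOnes-bound zero j = begin
    below 0 j + 0   ≡⟨ +-identityʳ (below 0 j) ⟩
    below 0 j       ≤⟨ below≤1 0 j ⟩
    1               ≤⟨ ^-monoʳ-≤ 3 {0} {j} z≤n ⟩
    3 ^ j           ≡⟨ *-identityʳ (3 ^ j) ⟨
    3 ^ j * 1       ∎
  where open ≤-Reasoning
fewOnes-bound (suc k) zero = ≤-trans (≤-reflexive noneBelowZero) z≤n
  where noneBelowZero : 3 ^ suc k * fewOnes (suc k) 0 ≡ 0
        noneBelowZero = trans (cong (λ z → 3 ^ suc k * (z + z)) (sumVecs-const k 0))
                              (*-zeroʳ (3 ^ suc k))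
fewOnes-bound (suc k) (suc j) = begin
    3 ^ suc k * (fewOnes k j + fewOnes k (suc j))
  ≡⟨ distrib (3 ^ k) (fewOnes k j) (fewOnes k (suc j)) ⟩
    3 * (3 ^ k * fewOnes k j) + 3 * (3 ^ k * fewOnes k (suc j))
  ≤⟨ +-mono-≤ (*-monoʳ-≤ 3 (fewOnes-bound k j)) (*-monoʳ-≤ 3 (fewOnes-bound k (suc j))) ⟩
    3 * (3 ^ j * 4 ^ k) + 3 * (3 ^ suc j * 4 ^ k)
  ≡⟨ collect (3 ^ j) (4 ^ k) ⟩
    3 ^ suc j * 4 ^ suc k ∎
  where open ≤-Reasoning
        distrib : ∀ a x y → (3 * a) * (x + y) ≡ 3 * (a * x) + 3 * (a * y)
        distrib = solve-∀
        collect : ∀ a b → 3 * (a * b) + 3 * ((3 * a) * b) ≡ (3 * a) * (4 * b)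
        collect = solve-∀

^-distribʳ-* : ∀ a b o → (a * b) ^ o ≡ a ^ o * b ^ o
^-distribʳ-* a b zero = refl
^-distribʳ-* a b (suc o) = trans (cong (a * b *_) (^-distribʳ-* a b o)) (shuffle a b (a ^ o) (b ^ o))
  where shuffle : ∀ a b x y → a * b * (x * y) ≡ a * x * (b * y)
        shuffle = solve-∀

-- At k = 10m this is 8m·6^m·2^(10m) < 3^(10m), by induction on m (each step multiplies
-- the left side by at most 2·6·2^10 = 12288 and the right side by 3^10 = 59049);
-- increasing k further multiplies the left side by 2 and the right side by 3.
module ExponentialGap where

  lhs : ℕ → ℕ
  lhs j = 6 ^ j * 2 ^ (10 * j)

  rhs : ℕ → ℕ
  rhs j = 3 ^ (10 * j)

  pow10-suc : ∀ b j → b ^ (10 * suc j) ≡ b ^ 10 * b ^ (10 * j)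
  pow10-suc b j = trans (cong (b ^_) (*-suc 10 j)) (^-distribˡ-+-* b 10 (10 * j))

  lhs-suc : ∀ j → lhs (suc j) ≡ 6144 * lhs j
  lhs-suc j = trans (cong (6 ^ suc j *_) (pow10-suc 2 j)) (collect (6 ^ j) (2 ^ (10 * j)))
    where collect : ∀ x y → (6 * x) * (1024 * y) ≡ 6144 * (x * y)
          collect = solve-∀

  atTenfold : ∀ j → 8 * suc j * lhs (suc j) < rhs (suc j)
  atTenfold zero = <ᵇ⇒< _ _ _
  atTenfold (suc j) = begin-strict
      8 * suc (suc j) * lhs (suc (suc j))
    ≡⟨ cong (8 * suc (suc j) *_) (lhs-suc (suc j)) ⟩
      8 * suc (suc j) * (6144 * lhs (suc j))
    ≤⟨ *-monoˡ-≤ (6144 * lhs (suc j)) (*-monoʳ-≤ 8 (s≤s (m≤n+m (suc j) j))) ⟩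
      8 * (suc j + suc j) * (6144 * lhs (suc j))
    ≡⟨ regroup (suc j) (lhs (suc j)) ⟩
      12288 * (8 * suc j * lhs (suc j))
    <⟨ *-monoʳ-< 12288 (atTenfold j) ⟩
      12288 * rhs (suc j)
    ≤⟨ *-monoˡ-≤ (rhs (suc j)) (<ᵇ⇒< 12287 59049 _) ⟩
      59049 * rhs (suc j)
    ≡⟨ pow10-suc 3 (suc j) ⟨
      rhs (suc (suc j)) ∎
    where open ≤-Reasoning
          regroup : ∀ a x → 8 * (a + a) * (6144 * x) ≡ 12288 * (8 * a * x)
          regroup = solve-∀

  beyond : ∀ A k₀ d → A * 2 ^ k₀ < 3 ^ k₀ → A * 2 ^ (d + k₀) < 3 ^ (d + k₀)
  beyond A k₀ zero hb = hb
  beyond A k₀ (suc d) hb = begin-strict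
      A * (2 * 2 ^ (d + k₀))
    ≡⟨ *-comm-middle A (2 ^ (d + k₀)) ⟩
      2 * (A * 2 ^ (d + k₀))
    <⟨ *-monoʳ-< 2 (beyond A k₀ d hb) ⟩
      2 * 3 ^ (d + k₀)
    ≤⟨ *-monoˡ-≤ (3 ^ (d + k₀)) {2} {3} (s≤s (s≤s z≤n)) ⟩
      3 * 3 ^ (d + k₀) ∎
    where open ≤-Reasoning
          *-comm-middle : ∀ a x → a * (2 * x) ≡ 2 * (a * x)
          *-comm-middle = solve-∀

  exponentialGap : ∀ m k → 1 ≤ m → 10 * m ≤ k → 8 * m * 6 ^ m * 2 ^ k < 3 ^ k
  exponentialGap (suc j) k _ 10m≤k =
    subst (λ z → 8 * suc j * 6 ^ suc j * 2 ^ z < 3 ^ z) (m∸n+n≡m 10m≤k)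
      (beyond (8 * suc j * 6 ^ suc j) (10 * suc j) (k ∸ 10 * suc j)
        (subst (_< rhs (suc j)) (sym (*-assoc (8 * suc j) (6 ^ suc j) (2 ^ (10 * suc j))))
               (atTenfold j)))

open ExponentialGap using (exponentialGap)

fewOnes-rare : ∀ m k → 1 ≤ m → 10 * m ≤ k → 8 * m * 2 ^ m * fewOnes k m < 2 ^ k
fewOnes-rare m k 1≤m 10m≤k = *-cancelˡ-< (3 ^ k) (8 * m * 2 ^ m * fewOnes k m) (2 ^ k) (begin-strict
    3 ^ k * (8 * m * 2 ^ m * fewOnes k m)
  ≡⟨ swap (3 ^ k) (8 * m * 2 ^ m) (fewOnes k m) ⟩
    8 * m * 2 ^ m * (3 ^ k * fewOnes k m)
  ≤⟨ *-monoʳ-≤ (8 * m * 2 ^ m) (fewOnes-bound k m) ⟩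
    8 * m * 2 ^ m * (3 ^ m * 4 ^ k)
  ≡⟨ cong (λ v → 8 * m * 2 ^ m * (3 ^ m * v)) (^-distribʳ-* 2 2 k) ⟩
    8 * m * 2 ^ m * (3 ^ m * (2 ^ k * 2 ^ k))
  ≡⟨ regroup m (2 ^ m) (3 ^ m) (2 ^ k) ⟩
    8 * m * (2 ^ m * 3 ^ m) * 2 ^ k * 2 ^ k
  ≡⟨ cong (λ u → 8 * m * u * 2 ^ k * 2 ^ k) (^-distribʳ-* 2 3 m) ⟨
    8 * m * 6 ^ m * 2 ^ k * 2 ^ k
  <⟨ *-monoˡ-< (2 ^ k) {{m^n≢0 2 k}} (exponentialGap m k 1≤m 10m≤k) ⟩
    3 ^ k * 2 ^ k ∎)
  where
  open ≤-Reasoning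
  swap : ∀ x y z → x * (y * z) ≡ y * (x * z)
  swap = solve-∀
  regroup : ∀ m p q r → 8 * m * p * (q * (r * r)) ≡ 8 * m * (p * q) * r * r
  regroup = solve-∀

unique⇒length≤ : ∀ {M} {xs : List (Fin M)} → Unique xs → length xs ≤ M
unique⇒length≤ {M} u = FinP.injective⇒≤ (lookup-injective u)
  where
  lookup-injective : ∀ {ys : List (Fin M)} → Unique ys →
    ∀ {i j} → L.lookup ys i ≡ L.lookup ys j → i ≡ j
  lookup-injective (_ ∷ _) {zero} {zero} _ = refl
  lookup-injective (x∉ ∷ _) {zero} {suc j} eq = ⊥-elim (All.lookup x∉ (∈-lookup j) eq)
  lookup-injective (x∉ ∷ _) {suc i} {zero} eq = ⊥-elim (All.lookup x∉ (∈-lookup i) (sym eq))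
  lookup-injective (_ ∷ u) {suc i} {suc j} eq = cong suc (lookup-injective u eq)

module Walks {N Mm : ℕ} (E : Edges N Mm) (wt : Fin Mm → ℕ) where

  Within : Fin N → Fin N → ℕ → Set
  Within u v d = Σ ℕ (λ d' → Walk E wt u v d' × d' ≤ d)

  joins-sym : ∀ {i u v} → Joins E i u v → Joins E i v u
  joins-sym (inj₁ x) = inj₂ x
  joins-sym (inj₂ y) = inj₁ y

  within-refl : ∀ {u} d → Within u u d
  within-refl d = 0 , here , z≤n

  within-mono : ∀ {u v d d''} → d ≤ d'' → Within u v d → Within u v d''
  within-mono le (d' , w , l) = d' , w , ≤-trans l le

  within-edge : ∀ {i u v} → Joins E i u v → Within u v (wt i)
  within-edge {i} J = (0 + wt i) , step i here J , ≤-refl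

  walk-++ : ∀ {u v x d₁ d₂} → Walk E wt u v d₁ → Walk E wt v x d₂ → Within u x (d₁ + d₂)
  walk-++ {d₁ = d₁} W here = d₁ , W , ≤-reflexive (sym (+-identityʳ d₁))
  walk-++ {d₁ = d₁} W (step {d = d₂} i W₂ J) with walk-++ W W₂
  ... | d' , W' , le = (d' + wt i) , step i W' J ,
        ≤-trans (+-monoˡ-≤ (wt i) le) (≤-reflexive (+-assoc d₁ d₂ (wt i)))

  within-trans : ∀ {u v x a b} → Within u v a → Within v x b → Within u x (a + b)
  within-trans (d₁ , W₁ , l₁) (d₂ , W₂ , l₂) = within-mono (+-mono-≤ l₁ l₂) (walk-++ W₁ W₂)

  walk-reverse : ∀ {u v d} → Walk E wt u v d → Within v u d
  walk-reverse here = within-refl 0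
  walk-reverse (step {d = d} i W J) =
    within-mono (≤-reflexive (+-comm (wt i) d))
      (within-trans (within-edge (joins-sym J)) (walk-reverse W))

  within-sym : ∀ {u v a} → Within u v a → Within v u a
  within-sym (d , W , l) = within-mono l (walk-reverse W)

  data Trail (u : Fin N) : Fin N → List (Fin Mm) → Set where
    here : Trail u u L.[]
    step : ∀ {v x es} (i : Fin Mm) → Trail u v es → All (i ≢_) es → Joins E i v x →
           Trail u x (i L.∷ es)

  trail-unique : ∀ {u v es} → Trail u v es → Unique es
  trail-unique here = AllPairs.[]
  trail-unique (step i W i∉ J) = i∉ ∷ trail-unique W

  TrailTo : Fin N → Fin N → Set
  TrailTo u v = Σ (List (Fin Mm)) (Trail u v)

  endpoints : ∀ {u y es i} → Trail u y es → i ∈ es →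
    TrailTo u (proj₁ (lookup E i)) × TrailTo u (proj₂ (lookup E i))
  endpoints (step {es = es} i W a (inj₁ eq)) (here refl) rewrite eq =
    (es , W) , (_ , step i W a (inj₁ eq))
  endpoints (step {es = es} i W a (inj₂ eq)) (here refl) rewrite eq =
    (_ , step i W a (inj₂ eq)) , (es , W)
  endpoints (step i W a J) (there i∈) = endpoints W i∈

  -- Any connection can be replaced by a trail: when an edge is about to be
  -- reused, cut back to the earlier trail ending at its far endpoint.
  reach⇒trail : ∀ {keep u v} → Reach E keep u v → TrailTo u v
  reach⇒trail here = L.[] , here
  reach⇒trail (step i R _ J) with reach⇒trail R
  ... | es , W with any? (i FinP.≟_) es
  ...   | no i∉ = (i L.∷ es) , step i W (¬Any⇒All¬ es i∉) J
  ...   | yes i∈ with endpoints W i∈ | J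
  ...     | _ , toSnd | inj₁ eq = subst (TrailTo _) (cong proj₂ eq) toSnd
  ...     | toFst , _ | inj₂ eq = subst (TrailTo _) (cong proj₁ eq) toFst

  trail-within : (∀ i → wt i ≤ 1) → ∀ {u v es} → Trail u v es → Within u v (length es)
  trail-within wt≤1 here = within-refl 0
  trail-within wt≤1 {es = _ L.∷ es} (step i W _ J) =
    within-mono (≤-trans (+-monoʳ-≤ (length es) (wt≤1 i)) (≤-reflexive (+-comm (length es) 1)))
      (within-trans (trail-within wt≤1 W) (within-edge J))

  reach⇒within : (∀ i → wt i ≤ 1) → ∀ {keep u v} → Reach E keep u v → Within u v Mm
  reach⇒within wt≤1 R with reach⇒trail R
  ... | es , W = within-mono (unique⇒length≤ (trail-unique W)) (trail-within wt≤1 W)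

  reach⇒within0 : ∀ {keep} → (∀ i → keep i ≡ true → wt i ≡ 0) →
    ∀ {u v} → Reach E keep u v → Within u v 0
  reach⇒within0 light here = within-refl 0
  reach⇒within0 light (step i R kept J) =
    within-trans (reach⇒within0 light R) (within-mono (≤-reflexive (light i kept)) (within-edge J))

  OnPath : ∀ {k} → Fin N → (Fin k → Fin N) → Fin N → Set
  OnPath {k} s₀ f x = x ≡ s₀ ⊎ Σ (Fin k) (λ j → x ≡ f j)

  path-within : ∀ k (s₀ : Fin N) (f : Fin k → Fin N) (av : Vec Bool k) →
    (∀ j → Within (prevOn s₀ f j) (f j) (bit (lookup av j))) →
    ∀ {x y} → OnPath s₀ f x → OnPath s₀ f y → Within x y (ones av)
  path-within zero s₀ f [] _ (inj₁ refl) (inj₁ refl) = within-refl 0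
  path-within zero s₀ f [] _ (inj₁ _) (inj₂ (() , _))
  path-within zero s₀ f [] _ (inj₂ (() , _)) _
  path-within (suc k) s₀ f (x₀ ∷ av) edges {x} {y} px py = go (split px) (split py)
    where
    tail : ∀ {x y} → OnPath (f zero) (λ j → f (suc j)) x → OnPath (f zero) (λ j → f (suc j)) y →
      Within x y (ones av)
    tail = path-within k (f zero) (λ j → f (suc j)) av λ where
      zero → edges (suc zero)
      (suc j) → edges (suc (suc j))
    split : ∀ {x} → OnPath s₀ f x → x ≡ s₀ ⊎ OnPath (f zero) (λ j → f (suc j)) x
    split (inj₁ e) = inj₁ e
    split (inj₂ (zero , e)) = inj₂ (inj₁ e)
    split (inj₂ (suc j , e)) = inj₂ (inj₂ (j , e))
    fromStart : ∀ {y} → OnPath (f zero) (λ j → f (suc j)) y → Within s₀ y (bit x₀ + ones av)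
    fromStart py = within-trans (edges zero) (tail (inj₁ refl) py)
    go : x ≡ s₀ ⊎ OnPath (f zero) (λ j → f (suc j)) x → y ≡ s₀ ⊎ OnPath (f zero) (λ j → f (suc j)) y →
      Within x y (bit x₀ + ones av)
    go (inj₁ refl) (inj₁ refl) = within-refl _
    go (inj₁ refl) (inj₂ py) = fromStart py
    go (inj₂ px) (inj₁ refl) = within-sym (fromStart px)
    go (inj₂ px) (inj₂ py) = within-mono (m≤n+m (ones av) (bit x₀)) (tail px py)

map-walk : ∀ {N Mm N' Mm'} {E : Edges N Mm} {wt : Fin Mm → ℕ} {E' : Edges N' Mm'} {wt' : Fin Mm' → ℕ}
  (φ : Fin N → Fin N') (ψ : Fin Mm → Fin Mm') →
  (∀ {i v x} → Joins E i v x → Joins E' (ψ i) (φ v) (φ x)) → (∀ i → wt' (ψ i) ≡ wt i) →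
  ∀ {u v d} → Walk E wt u v d → Walk E' wt' (φ u) (φ v) d
map-walk φ ψ joins weights here = here
map-walk {E' = E'} {wt' = wt'} φ ψ joins weights (step {d = d} i W J) =
  subst (Walk E' wt' _ _) (cong (d +_) (weights i)) (step (ψ i) (map-walk φ ψ joins weights W) (joins J))

module Extension (n m : ℕ) (E : Edges n m) (s t : Fin n) (k : ℕ) where

  V' : Set
  V' = Fin (n + k + k)

  M' : ℕ
  M' = m + suc (k + k)

  G' : Edges (n + k + k) M'
  G' = G'edges E s t k

  data Kind : Set where
    O : Fin n → Kind
    S : Fin k → Kind
    T : Fin k → Kind

  kind : V' → Kind
  kind x = [ (λ y → [ O , S ]′ (splitAt n y)) , T ]′ (splitAt (n + k) x)

  kind-old : ∀ v → kind (old k v) ≡ O v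
  kind-old v rewrite FinP.splitAt-↑ˡ (n + k) (v ↑ˡ k) k | FinP.splitAt-↑ˡ n v k = refl

  kind-newS : ∀ j → kind (newS n k j) ≡ S j
  kind-newS j rewrite FinP.splitAt-↑ˡ (n + k) (n ↑ʳ j) k | FinP.splitAt-↑ʳ n k j = refl

  kind-newT : ∀ j → kind (newT n k j) ≡ T j
  kind-newT j rewrite FinP.splitAt-↑ʳ (n + k) k j = refl

  data VertexView : V' → Set where
    vo : ∀ v → VertexView (old k v)
    vs : ∀ j → VertexView (newS n k j)
    vt : ∀ j → VertexView (newT n k j)

  vertexView : ∀ x → VertexView x
  vertexView x with splitAt (n + k) x in eq
  ... | inj₂ j = subst VertexView (FinP.splitAt⁻¹-↑ʳ eq) (vt j)
  ... | inj₁ y with splitAt n y in eq₂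
  ...   | inj₁ v = subst VertexView (trans (cong (_↑ˡ k) (FinP.splitAt⁻¹-↑ˡ eq₂)) (FinP.splitAt⁻¹-↑ˡ eq)) (vo v)
  ...   | inj₂ j = subst VertexView (trans (cong (_↑ˡ k) (FinP.splitAt⁻¹-↑ʳ eq₂)) (FinP.splitAt⁻¹-↑ˡ eq)) (vs j)

  data EdgeView : Fin M' → Set where
    eg : ∀ e → EdgeView (e ↑ˡ suc (k + k))
    est : EdgeView (m ↑ʳ zero)
    eS : ∀ j → EdgeView (m ↑ʳ suc (j ↑ˡ k))
    eT : ∀ j → EdgeView (m ↑ʳ suc (k ↑ʳ j))

  edgeView : ∀ i → EdgeView i
  edgeView i with splitAt m i in eq
  ... | inj₁ e = subst EdgeView (FinP.splitAt⁻¹-↑ˡ eq) (eg e)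
  ... | inj₂ zero = subst EdgeView (FinP.splitAt⁻¹-↑ʳ eq) est
  ... | inj₂ (suc r) with splitAt k r in eq₂
  ...   | inj₁ j = subst EdgeView (trans (cong (λ z → m ↑ʳ suc z) (FinP.splitAt⁻¹-↑ˡ eq₂)) (FinP.splitAt⁻¹-↑ʳ eq)) (eS j)
  ...   | inj₂ j = subst EdgeView (trans (cong (λ z → m ↑ʳ suc z) (FinP.splitAt⁻¹-↑ʳ eq₂)) (FinP.splitAt⁻¹-↑ʳ eq)) (eT j)

  private
    oldPair : Fin n × Fin n → V' × V'
    oldPair p = old k (proj₁ p) , old k (proj₂ p)

  edge-old : ∀ e → lookup G' (e ↑ˡ suc (k + k)) ≡ oldPair (lookup E e)
  edge-old e = trans (VP.lookup-++ˡ (V.map oldPair E) _ e) (VP.lookup-map e oldPair E)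

  edge-st : lookup G' (m ↑ʳ zero) ≡ (old k s , old k t)
  edge-st = VP.lookup-++ʳ (V.map oldPair E) _ zero

  edge-S : ∀ j → lookup G' (m ↑ʳ suc (j ↑ˡ k)) ≡ (prevOn (old k s) (newS n k) j , newS n k j)
  edge-S j = trans (VP.lookup-++ʳ (V.map oldPair E) _ (suc (j ↑ˡ k)))
                   (trans (VP.lookup-++ˡ (pathEdges k (old k s) (newS n k)) _ j) (VP.lookup∘tabulate _ j))

  edge-T : ∀ j → lookup G' (m ↑ʳ suc (k ↑ʳ j)) ≡ (prevOn (old k t) (newT n k) j , newT n k j)
  edge-T j = trans (VP.lookup-++ʳ (V.map oldPair E) _ (suc (k ↑ʳ j)))
                   (trans (VP.lookup-++ʳ (pathEdges k (old k s) (newS n k)) _ j) (VP.lookup∘tabulate _ j))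

  old-joins : ∀ {e v x} → Joins E e v x → Joins G' (e ↑ˡ suc (k + k)) (old k v) (old k x)
  old-joins {e} (inj₁ eq) = inj₁ (trans (edge-old e) (cong oldPair eq))
  old-joins {e} (inj₂ eq) = inj₂ (trans (edge-old e) (cong oldPair eq))

  module Weighting (g : Vec Bool m) (c : Bool) (a b : Vec Bool k) where

    wt : Fin M' → ℕ
    wt = weightOf (g ++ (c ∷ (a ++ b)))

    wt-old : ∀ e → wt (e ↑ˡ suc (k + k)) ≡ bit (lookup g e)
    wt-old e = cong bit (VP.lookup-++ˡ g _ e)

    wt-st : wt (m ↑ʳ zero) ≡ bit c
    wt-st = cong bit (VP.lookup-++ʳ g (c ∷ (a ++ b)) zero)

    wt-S : ∀ j → wt (m ↑ʳ suc (j ↑ˡ k)) ≡ bit (lookup a j)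
    wt-S j = cong bit (trans (VP.lookup-++ʳ g (c ∷ (a ++ b)) (suc (j ↑ˡ k))) (VP.lookup-++ˡ a b j))

    wt-T : ∀ j → wt (m ↑ʳ suc (k ↑ʳ j)) ≡ bit (lookup b j)
    wt-T j = cong bit (trans (VP.lookup-++ʳ g (c ∷ (a ++ b)) (suc (k ↑ʳ j))) (VP.lookup-++ʳ a b j))


-- The penalty Z of the st edge: 1 exactly when the edge is heavy (c = true) and
-- s, t are separated in the subgraph of light (weight-0) edges of G.
module Penalty {n m} (E : Edges n m) (s t : Fin n)
               (dec : ∀ (b : Vec Bool m) → Dec (Reach E (lookup b) s t)) where

  light : Vec Bool m → Fin m → Bool
  light g = lookup (V.map not g)

  separated : Vec Bool m → ℕ
  separated b = if isYes (dec b) then 0 else 1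

  penalty : Vec Bool m → Bool → ℕ
  penalty g true = separated (V.map not g)
  penalty g false = 0

  penalty≤1 : ∀ g c → penalty g c ≤ 1
  penalty≤1 g false = z≤n
  penalty≤1 g true with dec (V.map not g)
  ... | yes _ = z≤n
  ... | no _ = s≤s z≤n

  penalty-connected : ∀ g c → Reach E (light g) s t → penalty g c ≡ 0
  penalty-connected g false _ = refl
  penalty-connected g true r with dec (V.map not g)
  ... | yes _ = refl
  ... | no ¬r = ⊥-elim (¬r r)

  -- g ↦ complement of g preserves the uniform measure, so the penalty of a heavy st
  -- edge has the same total as the disconnection indicator.
  sum-penalty : sumVecs m (λ g → penalty g true) ≡ sum (L.map separated (allVecs m))
  sum-penalty = trans (sumVecs-not m separated) (sym (sum-allVecs m separated))

headsUpTo : ∀ {k} → Vec Bool k → ℕ → ℕ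
headsUpTo v zero = 0
headsUpTo [] (suc l) = 0
headsUpTo (x ∷ v) (suc l) = bit x + headsUpTo v l

headsUpTo-suc : ∀ {k} (v : Vec Bool k) (j : Fin k) →
  headsUpTo v (suc (toℕ j)) ≡ headsUpTo v (toℕ j) + bit (lookup v j)
headsUpTo-suc (x ∷ v) zero = +-comm (bit x) 0
headsUpTo-suc (x ∷ v) (suc j) = trans (cong (bit x +_) (headsUpTo-suc v j)) (sym (+-assoc (bit x) _ _))

headsUpTo-step : ∀ {k} (v : Vec Bool (suc k)) (j : Fin k) →
  headsUpTo v (suc (toℕ (suc j))) ≡ headsUpTo v (suc (toℕ (inject₁ j))) + bit (lookup v (suc j))
headsUpTo-step v j = trans (headsUpTo-suc v (suc j))
                           (cong (λ u → headsUpTo v (suc u) + bit (lookup v (suc j))) (sym (FinP.toℕ-inject₁ j)))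

headsUpTo-all : ∀ {k} (v : Vec Bool k) → headsUpTo v k ≡ ones v
headsUpTo-all [] = refl
headsUpTo-all (x ∷ v) = cong (bit x +_) (headsUpTo-all v)

module Weighted (n m : ℕ) (E : Edges n m) (s t : Fin n) (k : ℕ)
                (dec : ∀ (b : Vec Bool m) → Dec (Reach E (lookup b) s t))
                (g : Vec Bool m) (c : Bool) (a b : Vec Bool k) where

  open Extension n m E s t k
  open Weighting g c a b
  open Penalty E s t dec
  open Walks G' wt

  X Y Z : ℕ
  X = ones a
  Y = ones b
  Z = penalty g c

  old-within : ∀ {u v d} → Walks.Within E (weightOf g) u v d → Within (old k u) (old k v) d
  old-within (d' , W , d'≤d) = d' , map-walk (old k) (_↑ˡ suc (k + k)) old-joins wt-old W , d'≤d

  -- s and t are within distance Z: use the st edge, or a light s–t connection in G.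
  st-within : Within (old k s) (old k t) Z
  st-within = go c refl
    where
    edge : Within (old k s) (old k t) (bit c)
    edge = within-mono (≤-reflexive wt-st) (within-edge (inj₁ edge-st))
    isLight : ∀ i → light g i ≡ true → bit (lookup g i) ≡ 0
    isLight i lightᵢ with lookup g i in eq
    ... | false = refl
    ... | true with () ← trans (sym lightᵢ) (trans (VP.lookup-map i not g) (cong not eq))
    go : ∀ c' → c ≡ c' → Within (old k s) (old k t) (penalty g c')
    go false refl = edge
    go true refl with dec (V.map not g)
    ... | yes r = old-within (Walks.reach⇒within0 E (weightOf g) isLight r)
    ... | no _ = edge

  pathS-within : ∀ {x y} → OnPath (old k s) (newS n k) x → OnPath (old k s) (newS n k) y → Within x y X
  pathS-within = path-within k (old k s) (newS n k) a
    (λ j → within-mono (≤-reflexive (wt-S j)) (within-edge (inj₁ (edge-S j))))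

  pathT-within : ∀ {x y} → OnPath (old k t) (newT n k) x → OnPath (old k t) (newT n k) y → Within x y Y
  pathT-within = path-within k (old k t) (newT n k) b
    (λ j → within-mono (≤-reflexive (wt-T j)) (within-edge (inj₁ (edge-T j))))

  across : ∀ j j' → Within (newS n k j) (newT n k j') (X + Z + Y)
  across j j' = within-trans (within-trans (pathS-within (inj₂ (j , refl)) (inj₁ refl)) st-within)
                             (pathT-within (inj₁ refl) (inj₂ (j' , refl)))

  -- Old vertices are within m
  -- of each other, so the only pairs that might be far are covered by the penalty
  -- term unless X, Y ≥ m, in which case m ≤ X, Y absorbs the detours through G.
  module Upper (conn : Connected E) where

    bad : ℕ
    bad = below X m + below Y m

    bound : ℕ
    bound = X + Y + Z + (m + m) * bad

    old-pair-within : ∀ u v → Within (old k u) (old k v) m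
    old-pair-within u v =
      old-within (Walks.reach⇒within E (weightOf g) (λ i → bit≤1 (lookup g i)) (conn u v))

    scale : ∀ {y} → 1 ≤ y → m + m ≤ (m + m) * y
    scale {y} 1≤y = subst (_≤ (m + m) * y) (*-identityʳ (m + m)) (*-monoʳ-≤ (m + m) 1≤y)

    heavy-or-penalised : (m ≤ X × m ≤ Y) ⊎ (m + m ≤ (m + m) * bad)
    heavy-or-penalised with below-cases X m | below-cases Y m
    ... | inj₁ (m≤X , _) | inj₁ (m≤Y , _) = inj₁ (m≤X , m≤Y)
    ... | inj₁ _ | inj₂ e = inj₂ (scale (subst (λ u → 1 ≤ below X m + u) (sym e) (m≤n+m 1 (below X m))))
    ... | inj₂ e | _ = inj₂ (scale (subst (λ u → 1 ≤ u + below Y m) (sym e) (s≤s z≤n)))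

    byCases : ∀ {p} → (m ≤ X → m ≤ Y → p ≤ X + Y) → p ≤ m + m + (X + Y) → p ≤ bound
    byCases {p} heavy always with heavy-or-penalised
    ... | inj₁ (m≤X , m≤Y) = ≤-trans (heavy m≤X m≤Y) (≤-trans (m≤m+n (X + Y) Z) (m≤m+n _ _))
    ... | inj₂ penalised = begin
        p                                ≤⟨ always ⟩
        m + m + (X + Y)                  ≤⟨ +-mono-≤ penalised (m≤m+n (X + Y) Z) ⟩
        (m + m) * bad + (X + Y + Z)      ≡⟨ +-comm ((m + m) * bad) (X + Y + Z) ⟩
        bound                            ∎
      where open ≤-Reasoning

    withoutDetour : ∀ {p} → p ≤ X + Y + Z → p ≤ bound
    withoutDetour p≤ = ≤-trans p≤ (m≤m+n (X + Y + Z) _)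

    X≤ : X ≤ bound
    X≤ = withoutDetour (≤-trans (m≤m+n X Y) (m≤m+n (X + Y) Z))

    Y≤ : Y ≤ bound
    Y≤ = withoutDetour (≤-trans (m≤n+m Y X) (m≤m+n (X + Y) Z))

    XZY≤ : X + Z + Y ≤ bound
    XZY≤ = withoutDetour (≤-reflexive (+-swapʳ X Z Y))

    mm≤ : m + m ≤ bound
    mm≤ = byCases +-mono-≤ (m≤m+n (m + m) (X + Y))

    mX≤ : m + X ≤ bound
    mX≤ = byCases (λ _ m≤Y → ≤-trans (+-monoˡ-≤ X m≤Y) (≤-reflexive (+-comm Y X)))
                  (+-mono-≤ (m≤m+n m m) (m≤m+n X Y))

    mY≤ : m + Y ≤ bound
    mY≤ = byCases (λ m≤X _ → +-monoˡ-≤ Y m≤X) (+-mono-≤ (m≤m+n m m) (m≤n+m Y X))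

    s-onPath : OnPath (old k s) (newS n k) (old k s)
    s-onPath = inj₁ refl
    t-onPath : OnPath (old k t) (newT n k) (old k t)
    t-onPath = inj₁ refl

    pair-within : ∀ u v → Within u v bound
    pair-within u v = go (vertexView u) (vertexView v)
      where
      go : ∀ {u v} → VertexView u → VertexView v → Within u v bound
      go (vo p) (vo q) = within-mono mm≤ (within-trans (old-pair-within p s) (old-pair-within s q))
      go (vo p) (vs j) = within-mono mX≤ (within-trans (old-pair-within p s) (pathS-within s-onPath (inj₂ (j , refl))))
      go (vo p) (vt j) = within-mono mY≤ (within-trans (old-pair-within p t) (pathT-within t-onPath (inj₂ (j , refl))))
      go (vs j) (vo q) = within-sym (go (vo q) (vs j))
      go (vs j) (vs j') = within-mono X≤ (pathS-within (inj₂ (j , refl)) (inj₂ (j' , refl)))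
      go (vs j) (vt j') = within-mono XZY≤ (across j j')
      go (vt j) (vo q) = within-sym (go (vo q) (vt j))
      go (vt j) (vs j') = within-sym (go (vs j') (vt j))
      go (vt j) (vt j') = within-mono Y≤ (pathT-within (inj₂ (j , refl)) (inj₂ (j' , refl)))

    diameter≤ : ∀ D → IsDiameter G' wt D → D ≤ bound
    diameter≤ D ((u , v , (_ , minimal)) , _) =
      let (d , W , d≤) = pair-within u v in ≤-trans (minimal d W) d≤

  -- Lower bound through a potential φ on the vertices of G':
  --   φ(old v) = X + Z·[v is not joined to s by light edges of G],
  --   φ(a_j)   = X − (heads among a₀ … a_j),   φ(b_j) = φ(old t) + (heads among b₀ … b_j).
  -- Across every edge φ changes by at most the edge's weight, φ(s') = 0 and
  -- φ(t') = X + Y + Z.  Light connectivity to s is only decidable at t, so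
  -- "φ(x) ≤ d" is stated as the relation Below x d rather than computed.
  module Lower where

    Lightly : Fin n → Set
    Lightly v = Reach E (light g) s v

    headsA headsB : Fin k → ℕ
    headsA j = headsUpTo a (suc (toℕ j))
    headsB j = headsUpTo b (suc (toℕ j))

    BelowK : Kind → ℕ → Set
    BelowK (O v) d = X ≤ d × (X + Z ≤ d ⊎ Lightly v)
    BelowK (S j) d = X ≤ d + headsA j
    BelowK (T j) d = X + headsB j ≤ d × (X + Z + headsB j ≤ d ⊎ Lightly t)

    Below : V' → ℕ → Set
    Below x d = BelowK (kind x) d

    -- an edge of G: a light edge extends the light component, a heavy one pays for Z
    oldStep : ∀ {p q e d} → Joins E e p q → BelowK (O p) d → BelowK (O q) (d + bit (lookup g e))
    oldStep {p} {q} {e} J (X≤d , rest) with lookup g e in eq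
    ... | true = m≤n⇒m≤n+o 1 X≤d , inj₁ (+-mono-≤ X≤d (penalty≤1 g c))
    ... | false = m≤n⇒m≤n+o 0 X≤d , map₁ (m≤n⇒m≤n+o 0) (map₂ extend rest)
      where
      extend : Lightly p → Lightly q
      extend r = step e r (trans (VP.lookup-map e not g) (cong not eq)) J

    -- the st edge: heavy, it pays for Z; light, Z = 0
    stStep : ∀ {d} → BelowK (O s) d → BelowK (O t) (d + bit c)
    stStep {d} (X≤d , _) = m≤n⇒m≤n+o (bit c) X≤d , inj₁ (paid c refl)
      where
      paid : ∀ c' → c ≡ c' → X + penalty g c ≤ d + bit c'
      paid true _ = +-mono-≤ X≤d (penalty≤1 g c)
      paid false refl = +-monoˡ-≤ 0 X≤d

    tsStep : ∀ {d} → BelowK (O t) d → BelowK (O s) (d + bit c)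
    tsStep (X≤d , _) = m≤n⇒m≤n+o (bit c) X≤d , inj₂ here

    prevS prevT : Fin k → Kind
    prevS zero = O s
    prevS (suc j) = S (inject₁ j)
    prevT zero = O t
    prevT (suc j) = T (inject₁ j)

    kind-prevS : ∀ j → kind (prevOn (old k s) (newS n k) j) ≡ prevS j
    kind-prevS zero = kind-old s
    kind-prevS (suc j) = kind-newS (inject₁ j)

    kind-prevT : ∀ j → kind (prevOn (old k t) (newT n k) j) ≡ prevT j
    kind-prevT zero = kind-old t
    kind-prevT (suc j) = kind-newT (inject₁ j)

    sStep : ∀ j {d} → BelowK (prevS j) d → BelowK (S j) (d + bit (lookup a j))
    sStep zero (X≤d , _) = m≤n⇒m≤n+o (headsA zero) (m≤n⇒m≤n+o (bit (lookup a zero)) X≤d)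
    sStep (suc j) {d} X≤ rewrite headsUpTo-step a j =
      ≤-trans X≤ (+-mono-≤ (m≤m+n d _) (m≤m+n (headsA (inject₁ j)) _))

    sBack : ∀ j {d} → BelowK (S j) d → BelowK (prevS j) (d + bit (lookup a j))
    sBack zero {d} X≤ = subst (λ u → X ≤ d + u) (headsUpTo-suc a zero) X≤ , inj₂ here
    sBack (suc j) {d} X≤ rewrite headsUpTo-step a j = subst (X ≤_) (swap d (headsA (inject₁ j)) _) X≤
      where swap : ∀ d p w → d + (p + w) ≡ d + w + p
            swap = solve-∀

    TBound : ℕ → ℕ → Set
    TBound p d = X + p ≤ d × (X + Z + p ≤ d ⊎ Lightly t)

    tUp : ∀ {p d} w → TBound p d → TBound (p + w) (d + w)
    tUp {p} {d} w = Product.map (up X) (map₁ (up (X + Z)))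
      where up : ∀ B → B + p ≤ d → B + (p + w) ≤ d + w
            up B h = subst (_≤ d + w) (+-assoc B p w) (+-monoˡ-≤ w h)

    tDown : ∀ {p d} w → TBound (p + w) d → TBound p (d + w)
    tDown {p} {d} w = Product.map (down X) (map₁ (down (X + Z)))
      where down : ∀ B → B + (p + w) ≤ d → B + p ≤ d + w
            down B h = m≤n⇒m≤n+o w (≤-trans (m≤m+n (B + p) w) (subst (_≤ d) (sym (+-assoc B p w)) h))

    tStep : ∀ j {d} → BelowK (prevT j) d → BelowK (T j) (d + bit (lookup b j))
    tStep zero {d} (X≤d , rest) rewrite headsUpTo-suc b zero =
      tUp (bit (lookup b zero)) (add0 X X≤d , map₁ (add0 (X + Z)) rest)
      where add0 : ∀ B → B ≤ d → B + 0 ≤ d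
            add0 B = subst (_≤ d) (sym (+-identityʳ B))
    tStep (suc j) bound rewrite headsUpTo-step b j = tUp _ bound

    tBack : ∀ j {d} → BelowK (T j) d → BelowK (prevT j) (d + bit (lookup b j))
    tBack zero {d} bound rewrite headsUpTo-suc b zero with tDown (bit (lookup b zero)) bound
    ... | X0≤ , rest = drop0 X X0≤ , map₁ (drop0 (X + Z)) rest
      where drop0 : ∀ B → B + 0 ≤ d + bit (lookup b zero) → B ≤ d + bit (lookup b zero)
            drop0 B = subst (_≤ _) (+-identityʳ B)
    tBack (suc j) bound rewrite headsUpTo-step b j = tDown _ bound

    bothWays : ∀ {i P Q KP KQ w} → lookup G' i ≡ (P , Q) → kind P ≡ KP → kind Q ≡ KQ → wt i ≡ w →
      (∀ {d} → BelowK KP d → BelowK KQ (d + w)) → (∀ {d} → BelowK KQ d → BelowK KP (d + w)) →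
      ∀ {v x d} → Joins G' i v x → Below v d → Below x (d + wt i)
    bothWays eq kP kQ refl forward backward (inj₁ e) h with trans (sym eq) e
    ... | refl rewrite kP | kQ = forward h
    bothWays eq kP kQ refl forward backward (inj₂ e) h with trans (sym eq) e
    ... | refl rewrite kP | kQ = backward h

    edge-preserves : ∀ {i v x d} → Joins G' i v x → Below v d → Below x (d + wt i)
    edge-preserves {i} = go (edgeView i)
      where
      go : ∀ {i} → EdgeView i → ∀ {v x d} → Joins G' i v x → Below v d → Below x (d + wt i)
      go (eg e) = bothWays (edge-old e) (kind-old _) (kind-old _) (wt-old e)
                           (oldStep (inj₁ refl)) (oldStep (inj₂ refl))
      go est = bothWays edge-st (kind-old s) (kind-old t) wt-st stStep tsStep
      go (eS j) = bothWays (edge-S j) (kind-prevS j) (kind-newS j) (wt-S j) (sStep j) (sBack j)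
      go (eT j) = bothWays (edge-T j) (kind-prevT j) (kind-newT j) (wt-T j) (tStep j) (tBack j)

    walk-preserves : ∀ {u x d} → Below u 0 → Walk G' wt u x d → Below x d
    walk-preserves h₀ here = h₀
    walk-preserves h₀ (step i W J) = edge-preserves J (walk-preserves h₀ W)

  module Ends (ℓ : Fin k) (ℓ-last : suc (toℕ ℓ) ≡ k) where
    open Lower

    s' t' : V'
    s' = newS n k ℓ
    t' = newT n k ℓ

    heads-last : ∀ (v : Vec Bool k) → headsUpTo v (suc (toℕ ℓ)) ≡ ones v
    heads-last v = trans (cong (headsUpTo v) ℓ-last) (headsUpTo-all v)

    start : Below s' 0
    start = subst (λ K → BelowK K 0) (sym (kind-newS ℓ)) (≤-reflexive (sym (heads-last a)))

    walk-s't'≥ : ∀ {d} → Walk G' wt s' t' d → X + Y + Z ≤ d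
    walk-s't'≥ {d} W with subst (λ K → BelowK K d) (kind-newT ℓ) (walk-preserves start W)
    ... | _ , inj₁ XZY≤d =
      subst (_≤ d) (trans (cong (X + Z +_) (heads-last b)) (+-swapʳ X Z Y)) XZY≤d
    ... | XY≤d , inj₂ lightly = subst (_≤ d) noPenalty XY≤d
      where noPenalty : X + headsB ℓ ≡ X + Y + Z
            noPenalty = begin
              X + headsB ℓ    ≡⟨ cong (X +_) (heads-last b) ⟩
              X + Y           ≡⟨ +-identityʳ (X + Y) ⟨
              X + Y + 0       ≡⟨ cong (X + Y +_) (penalty-connected g c lightly) ⟨
              X + Y + Z       ∎
              where open ≡-Reasoning

    s't'-distance : IsDist G' wt s' t' (X + Y + Z)
    s't'-distance with across ℓ ℓ
    ... | d , W , d≤ = subst (Walk G' wt s' t') d≡ W , λ _ → walk-s't'≥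
      where d≡ : d ≡ X + Y + Z
            d≡ = ≤-antisym (≤-trans d≤ (≤-reflexive (+-swapʳ X Z Y))) (walk-s't'≥ W)

    diameter≥ : ∀ D → IsDiameter G' wt D → X + Y + Z ≤ D
    diameter≥ D (_ , maximal) = maximal s' t' (X + Y + Z) s't'-distance

module Blocks (m k : ℕ) where

  Block→ℕ : Set
  Block→ℕ = Vec Bool m → Bool → Vec Bool k → Vec Bool k → ℕ

  overPaths : Block→ℕ → Vec Bool m → Bool → ℕ
  overPaths F g c = sumVecs k (λ a → sumVecs k (λ b → F g c a b))

  sumBlocks : Block→ℕ → ℕ
  sumBlocks F = sumVecs m (λ g → overPaths F g true + overPaths F g false)

  sumBlocks-split : ∀ (F : Vec Bool (m + suc (k + k)) → ℕ) →
    sumVecs (m + suc (k + k)) F ≡ sumBlocks (λ g c a b → F (g ++ (c ∷ (a ++ b))))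
  sumBlocks-split F = trans (sumVecs-++ m (suc (k + k)) F)
                     (sumVecs-cong m (λ g → cong₂ _+_ (sumVecs-++ k k _) (sumVecs-++ k k _)))

  sumBlocks-mono : ∀ {F G} → (∀ g c a b → F g c a b ≤ G g c a b) → sumBlocks F ≤ sumBlocks G
  sumBlocks-mono {F} {G} F≤G = sumVecs-mono m (λ g → +-mono-≤ (paths g true) (paths g false))
    where paths : ∀ g c → overPaths F g c ≤ overPaths G g c
          paths g c = sumVecs-mono k (λ a → sumVecs-mono k (λ b → F≤G g c a b))

  sumBlocks-+ : ∀ F G → sumBlocks (λ g c a b → F g c a b + G g c a b) ≡ sumBlocks F + sumBlocks G
  sumBlocks-+ F G = trans (sumVecs-cong m perG) (sumVecs-+ m _ _)
    where
    paths : ∀ g c → overPaths (λ g c a b → F g c a b + G g c a b) g c ≡ overPaths F g c + overPaths G g c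
    paths g c = trans (sumVecs-cong k (λ a → sumVecs-+ k _ _)) (sumVecs-+ k _ _)
    perG : ∀ g → overPaths (λ g c a b → F g c a b + G g c a b) g true
                   + overPaths (λ g c a b → F g c a b + G g c a b) g false
                 ≡ (overPaths F g true + overPaths F g false) + (overPaths G g true + overPaths G g false)
    perG g = trans (cong₂ _+_ (paths g true) (paths g false))
                   (+-interchange (overPaths F g true) (overPaths G g true)
                                  (overPaths F g false) (overPaths G g false))

  sumBlocks-*ˡ : ∀ x F → sumBlocks (λ g c a b → x * F g c a b) ≡ x * sumBlocks F
  sumBlocks-*ˡ x F = trans (sumVecs-cong m perG) (sumVecs-*ˡ m x _)
    where
    paths : ∀ g c → overPaths (λ g c a b → x * F g c a b) g c ≡ x * overPaths F g c
    paths g c = trans (sumVecs-cong k (λ a → sumVecs-*ˡ k x _)) (sumVecs-*ˡ k x _)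
    perG : ∀ g → overPaths (λ g c a b → x * F g c a b) g true + overPaths (λ g c a b → x * F g c a b) g false
                 ≡ x * (overPaths F g true + overPaths F g false)
    perG g = trans (cong₂ _+_ (paths g true) (paths g false)) (sym (*-distribˡ-+ x _ _))

module Averages {n m} (E : Edges n m) (s t : Fin n)
                (dec : ∀ (b : Vec Bool m) → Dec (Reach E (lookup b) s t)) (k : ℕ) where
  open Penalty E s t dec
  open Blocks m k

  M T : ℕ
  M = m + suc (k + k)
  T = 2 ^ suc (k + k)

  -- 2^m · P, the number of keep-vectors separating s from t
  separating : ℕ
  separating = sum (L.map separated (allVecs m))

  low : Block→ℕ
  low g c a b = ones a + ones b + penalty g c

  excess : Block→ℕ
  excess g c a b = (m + m) * (below (ones a) m + below (ones b) m)

  sum-low : 2 * sumBlocks low ≡ separating * T + 2 * k * 2 ^ M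
  sum-low = begin
      2 * sumBlocks low
    ≡⟨ cong (2 *_) (sumVecs-cong m perG) ⟩
      2 * sumVecs m (λ g → 4 * (C * K) + penalty g true * (K * K))
    ≡⟨ cong (2 *_) (sumVecs-+ m (λ _ → 4 * (C * K)) (λ g → penalty g true * (K * K))) ⟩
      2 * (sumVecs m (λ _ → 4 * (C * K)) + sumVecs m (λ g → penalty g true * (K * K)))
    ≡⟨ cong (λ u → 2 * (u + sumVecs m (λ g → penalty g true * (K * K)))) (sumVecs-const m _) ⟩
      2 * (4 * (C * K) * 2 ^ m + sumVecs m (λ g → penalty g true * (K * K)))
    ≡⟨ cong (λ u → 2 * (4 * (C * K) * 2 ^ m + u))
            (trans (sumVecs-*ʳ m (K * K) (λ g → penalty g true)) (cong (_* (K * K)) sum-penalty)) ⟩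
      2 * (4 * (C * K) * 2 ^ m + separating * (K * K))
    ≡⟨ regroup C K (2 ^ m) separating ⟩
      4 * (2 * C) * K * 2 ^ m + separating * (2 * (K * K))
    ≡⟨ cong (λ u → 4 * u * K * 2 ^ m + separating * (2 * (K * K))) (sumVecs-ones k) ⟩
      4 * (k * K) * K * 2 ^ m + separating * (2 * (K * K))
    ≡⟨ collect k K (2 ^ m) separating ⟩
      separating * (2 * (K * K)) + 2 * k * (2 ^ m * (2 * (K * K)))
    ≡⟨ cong₂ (λ u v → separating * u + 2 * k * v) (sym T≡) (trans (cong (2 ^ m *_) (sym T≡)) (sym M≡)) ⟩
      separating * T + 2 * k * 2 ^ M ∎
    where
    open ≡-Reasoning
    K = 2 ^ k
    C = sumVecs k ones
    T≡ : T ≡ 2 * (K * K)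
    T≡ = cong (2 *_) (^-distribˡ-+-* 2 k k)
    M≡ : 2 ^ M ≡ 2 ^ m * T
    M≡ = ^-distribˡ-+-* 2 m (suc (k + k))
    perG : ∀ g → overPaths low g true + overPaths low g false ≡ 4 * (C * K) + penalty g true * (K * K)
    perG g = trans (cong₂ _+_ (sumVecs-separable k ones ones (penalty g true))
                              (sumVecs-separable k ones ones 0))
                   (simplify C K (penalty g true))
      where simplify : ∀ C K Z → C * K + (C + Z * K) * K + (C * K + (C + 0 * K) * K)
                                    ≡ 4 * (C * K) + Z * (K * K)
            simplify = solve-∀
    regroup : ∀ C K P Q → 2 * (4 * (C * K) * P + Q * (K * K)) ≡ 4 * (2 * C) * K * P + Q * (2 * (K * K))
    regroup = solve-∀
    collect : ∀ k K P Q → 4 * (k * K) * K * P + Q * (2 * (K * K)) ≡ Q * (2 * (K * K)) + 2 * k * (P * (2 * (K * K)))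
    collect = solve-∀

  sum-excess< : 1 ≤ m → 10 * m ≤ k → 2 * sumBlocks excess < T
  sum-excess< 1≤m 10m≤k = begin-strict
      2 * sumBlocks excess
    ≡⟨ cong (2 *_) (sumBlocks-*ˡ (m + m) tails) ⟩
      2 * ((m + m) * sumBlocks tails)
    ≡⟨ cong (λ u → 2 * ((m + m) * u)) (trans (sumVecs-cong m (λ g → cong₂ _+_ (perC {g} {true}) (perC {g} {false}))) (sumVecs-const m _)) ⟩
      2 * ((m + m) * ((perPaths + perPaths) * 2 ^ m))
    ≡⟨ regroup F K m (2 ^ m) ⟩
      (2 * K) * (8 * m * 2 ^ m * F)
    <⟨ *-monoʳ-< (2 * K) {{m*n≢0 2 K {{_}} {{m^n≢0 2 k}}}} (fewOnes-rare m k 1≤m 10m≤k) ⟩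
      (2 * K) * K
    ≡⟨ *-assoc 2 K K ⟩
      2 * (K * K)
    ≡⟨ cong (2 *_) (^-distribˡ-+-* 2 k k) ⟨
      T ∎
    where
    open ≤-Reasoning
    K = 2 ^ k
    F = fewOnes k m
    tails : Block→ℕ
    tails g c a b = below (ones a) m + below (ones b) m
    perPaths = F * K + (F + 0 * K) * K
    perC : ∀ {g c} → overPaths tails g c ≡ perPaths
    perC = trans (sumVecs-cong k (λ a → sumVecs-cong k (λ b → sym (+-identityʳ _))))
                 (sumVecs-separable k (λ a → below (ones a) m) (λ b → below (ones b) m) 0)
    regroup : ∀ F K m P → 2 * ((m + m) * ((F * K + (F + 0 * K) * K + (F * K + (F + 0 * K) * K)) * P))
                            ≡ (2 * K) * (8 * m * P * F)
    regroup = solve-∀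

  sum-bounds : 1 ≤ m → 10 * m ≤ k → (D : Vec Bool M → ℕ) →
    (∀ g c a b → low g c a b ≤ D (g ++ (c ∷ (a ++ b)))) →
    (∀ g c a b → D (g ++ (c ∷ (a ++ b))) ≤ low g c a b + excess g c a b) →
    let SD = sum (L.map D (allVecs M)) in
    (separating * T + 2 * k * 2 ^ M ≤ 2 * SD) × (2 * SD < (separating + 1) * T + 2 * k * 2 ^ M)
  sum-bounds 1≤m 10m≤k D low≤D D≤ = lower , upper
    where
    SD : ℕ
    SD = sum (L.map D (allVecs M))
    SD≡ : SD ≡ sumBlocks (λ g c a b → D (g ++ (c ∷ (a ++ b))))
    SD≡ = trans (sum-allVecs M D) (sumBlocks-split D)
    lower : separating * T + 2 * k * 2 ^ M ≤ 2 * SD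
    lower = subst₂ _≤_ sum-low (cong (2 *_) (sym SD≡)) (*-monoʳ-≤ 2 (sumBlocks-mono low≤D))
    upper : 2 * SD < (separating + 1) * T + 2 * k * 2 ^ M
    upper = begin-strict
        2 * SD
      ≡⟨ cong (2 *_) SD≡ ⟩
        2 * sumBlocks (λ g c a b → D (g ++ (c ∷ (a ++ b))))
      ≤⟨ *-monoʳ-≤ 2 (sumBlocks-mono D≤) ⟩
        2 * sumBlocks (λ g c a b → low g c a b + excess g c a b)
      ≡⟨ trans (cong (2 *_) (sumBlocks-+ low excess)) (*-distribˡ-+ 2 (sumBlocks low) (sumBlocks excess)) ⟩
        2 * sumBlocks low + 2 * sumBlocks excess
      <⟨ +-mono-≤-< (≤-reflexive sum-low) (sum-excess< 1≤m 10m≤k) ⟩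
        separating * T + 2 * k * 2 ^ M + T
      ≡⟨ shift separating T (2 * k * 2 ^ M) ⟩
        (separating + 1) * T + 2 * k * 2 ^ M ∎
      where open ≤-Reasoning
            shift : ∀ Q T B → Q * T + B + T ≡ (Q + 1) * T + B
            shift = solve-∀

module Dyadic where

  nat : ℕ → ℚ
  nat a = dyadic a 0

  natᵘ : ℕ → ℚᵘ
  natᵘ a = mkℚᵘ (ℤ.+ a) 0

  nat≃ : ∀ a → toℚᵘ (nat a) ℚᵘ.≃ natᵘ a
  nat≃ a = ℚP.toℚᵘ-fromℚᵘ (natᵘ a)

  natᵘ-+ : ∀ a b → natᵘ (a + b) ℚᵘ.≃ (natᵘ a ℚᵘ.+ natᵘ b)
  natᵘ-+ a b = *≡* (trans (cong (ℤ._* ℤ.1ℤ) (ℤP.pos-+ a b)) (distrib (ℤ.+ a) (ℤ.+ b)))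
    where distrib : ∀ (x y : ℤ.ℤ) → (x ℤ.+ y) ℤ.* ℤ.1ℤ ≡ (x ℤ.* ℤ.1ℤ ℤ.+ y ℤ.* ℤ.1ℤ) ℤ.* ℤ.1ℤ
          distrib = ℤSolver.solve-∀

  natᵘ-* : ∀ a b → natᵘ (a * b) ℚᵘ.≃ (natᵘ a ℚᵘ.* natᵘ b)
  natᵘ-* a b = *≡* (cong (ℤ._* ℤ.1ℤ) (ℤP.pos-* a b))

  nat-+ : ∀ a b → nat (a + b) ≡ nat a ℚ.+ nat b
  nat-+ a b = ℚP.toℚᵘ-injective (ℚᵘP.≃-trans (nat≃ (a + b)) (ℚᵘP.≃-trans (natᵘ-+ a b)
    (ℚᵘP.≃-sym (ℚᵘP.≃-trans (ℚP.toℚᵘ-homo-+ (nat a) (nat b)) (ℚᵘP.+-cong (nat≃ a) (nat≃ b))))))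

  nat-* : ∀ a b → nat (a * b) ≡ nat a ℚ.* nat b
  nat-* a b = ℚP.toℚᵘ-injective (ℚᵘP.≃-trans (nat≃ (a * b)) (ℚᵘP.≃-trans (natᵘ-* a b)
    (ℚᵘP.≃-sym (ℚᵘP.≃-trans (ℚP.toℚᵘ-homo-* (nat a) (nat b)) (ℚᵘP.*-cong (nat≃ a) (nat≃ b))))))

  nat-≤ : ∀ {a b} → a ≤ b → nat a ℚ.≤ nat b
  nat-≤ {a} {b} a≤b = ℚP.toℚᵘ-cancel-≤ (ℚᵘP.≤-respˡ-≃ (ℚᵘP.≃-sym (nat≃ a)) (ℚᵘP.≤-respʳ-≃ (ℚᵘP.≃-sym (nat≃ b))
    (*≤* (subst₂ ℤ._≤_ (sym (ℤP.*-identityʳ (ℤ.+ a))) (sym (ℤP.*-identityʳ (ℤ.+ b))) (ℤ.+≤+ a≤b)))))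

  nat-< : ∀ {a b} → a < b → nat a ℚ.< nat b
  nat-< {a} {b} a<b = ℚP.toℚᵘ-cancel-< (ℚᵘP.<-respˡ-≃ (ℚᵘP.≃-sym (nat≃ a)) (ℚᵘP.<-respʳ-≃ (ℚᵘP.≃-sym (nat≃ b))
    (*<* (subst₂ ℤ._<_ (sym (ℤP.*-identityʳ (ℤ.+ a))) (sym (ℤP.*-identityʳ (ℤ.+ b))) (ℤ.+<+ a<b)))))

  2^≡suc : ∀ e → Σ ℕ (λ d → 2 ^ e ≡ suc d)
  2^≡suc zero = 0 , refl
  2^≡suc (suc e) with 2^≡suc e
  ... | d , eq = (d + 1 * suc d) , cong (2 *_) eq

  dyadic-scale : ∀ a e → dyadic a e ℚ.* nat (2 ^ e) ≡ nat a
  dyadic-scale a e with 2^≡suc e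
  ... | d , eq = ℚP.toℚᵘ-injective (ℚᵘP.≃-trans (ℚP.toℚᵘ-homo-* (dyadic a e) (nat (2 ^ e)))
     (ℚᵘP.≃-trans (ℚᵘP.*-cong unnormalised (ℚᵘP.≃-trans (nat≃ (2 ^ e)) (ℚᵘP.≃-reflexive (cong natᵘ eq))))
     (ℚᵘP.≃-trans cancel (ℚᵘP.≃-sym (nat≃ a)))))
    where
    unnormalised : toℚᵘ (dyadic a e) ℚᵘ.≃ mkℚᵘ (ℤ.+ a) d
    unnormalised = ℚᵘP.≃-trans (ℚP.toℚᵘ-cong (ℚP./-cong {ℤ.+ a} {2 ^ e} {ℤ.+ a} {suc d} {{m^n≢0 2 e}} refl eq))
                               (ℚP.toℚᵘ-fromℚᵘ (mkℚᵘ (ℤ.+ a) d))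
    cancel : (mkℚᵘ (ℤ.+ a) d ℚᵘ.* natᵘ (suc d)) ℚᵘ.≃ natᵘ a
    cancel = *≡* (trans (ℤP.*-identityʳ _) (cong (ℤ.+ a ℤ.*_) (cong ℤ.+_ (sym (*-identityʳ (suc d))))))

  open +-*-Solver using (solve; _:=_; _:+_; _:*_; _:-_)

  dyadic-rescale : ∀ a m r → dyadic a m ℚ.* nat (2 ^ (m + r)) ≡ nat (a * 2 ^ r)
  dyadic-rescale a m r = begin
      dyadic a m ℚ.* nat (2 ^ (m + r))               ≡⟨ cong (λ z → dyadic a m ℚ.* nat z) (^-distribˡ-+-* 2 m r) ⟩
      dyadic a m ℚ.* nat (2 ^ m * 2 ^ r)             ≡⟨ cong (dyadic a m ℚ.*_) (nat-* (2 ^ m) (2 ^ r)) ⟩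
      dyadic a m ℚ.* (nat (2 ^ m) ℚ.* nat (2 ^ r))   ≡⟨ ℚP.*-assoc (dyadic a m) (nat (2 ^ m)) (nat (2 ^ r)) ⟨
      dyadic a m ℚ.* nat (2 ^ m) ℚ.* nat (2 ^ r)     ≡⟨ cong (ℚ._* nat (2 ^ r)) (dyadic-scale a m) ⟩
      nat a ℚ.* nat (2 ^ r)                          ≡⟨ nat-* a (2 ^ r) ⟨
      nat (a * 2 ^ r)                                ∎
    where open ≡-Reasoning

  -- 2(S / 2^M − k) · 2^M = 2S − 2k·2^M, provided the right-hand side is not truncated
  centred-rescale : ∀ S M k → 2 * k * 2 ^ M ≤ 2 * S →
    (1ℚ ℚ.+ 1ℚ) ℚ.* (dyadic S M ℚ.- nat k) ℚ.* nat (2 ^ M) ≡ nat (2 * S ∸ 2 * k * 2 ^ M)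
  centred-rescale S M k B≤ = begin
      (1ℚ ℚ.+ 1ℚ) ℚ.* (dyadic S M ℚ.- nat k) ℚ.* nat N
    ≡⟨ expand (nat 2) (dyadic S M) (nat k) (nat N) ⟩
      nat 2 ℚ.* (dyadic S M ℚ.* nat N) ℚ.- nat 2 ℚ.* nat k ℚ.* nat N
    ≡⟨ cong₂ ℚ._-_ (cong (nat 2 ℚ.*_) (dyadic-scale S M)) refl ⟩
      nat 2 ℚ.* nat S ℚ.- nat 2 ℚ.* nat k ℚ.* nat N
    ≡⟨ cong₂ ℚ._-_ (sym (nat-* 2 S)) (trans (cong (ℚ._* nat N) (sym (nat-* 2 k))) (sym (nat-* (2 * k) N))) ⟩
      nat (2 * S) ℚ.- nat B
    ≡⟨ cong (λ z → nat z ℚ.- nat B) (sym (m∸n+n≡m B≤)) ⟩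
      nat (2 * S ∸ B + B) ℚ.- nat B
    ≡⟨ cong (ℚ._- nat B) (nat-+ (2 * S ∸ B) B) ⟩
      (nat (2 * S ∸ B) ℚ.+ nat B) ℚ.- nat B
    ≡⟨ cancel (nat (2 * S ∸ B)) (nat B) ⟩
      nat (2 * S ∸ B) ∎
    where
    open ≡-Reasoning
    N = 2 ^ M
    B = 2 * k * N
    expand : ∀ (two E K R : ℚ) → (two ℚ.* (E ℚ.- K)) ℚ.* R ≡ two ℚ.* (E ℚ.* R) ℚ.- two ℚ.* K ℚ.* R
    expand = solve 4 (λ two E K R → (two :* (E :- K)) :* R := two :* (E :* R) :- two :* K :* R) refl
    cancel : ∀ (x b : ℚ) → (x ℚ.+ b) ℚ.- b ≡ x
    cancel = solve 2 (λ x b → (x :+ b) :- b := x) refl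

  fromScaled : ∀ m k Q SD →
    let M = m + suc (k + k); T = 2 ^ suc (k + k) in
    Q * T + 2 * k * 2 ^ M ≤ 2 * SD →
    2 * SD < (Q + 1) * T + 2 * k * 2 ^ M →
    (dyadic Q m ℚ.≤ (1ℚ ℚ.+ 1ℚ) ℚ.* (dyadic SD M ℚ.- dyadic k 0)) ×
    ((1ℚ ℚ.+ 1ℚ) ℚ.* (dyadic SD M ℚ.- dyadic k 0) ℚ.< dyadic Q m ℚ.+ dyadic 1 m)
  fromScaled m k Q SD lower upper =
    ℚP.*-cancelʳ-≤-pos (nat N) (subst₂ ℚ._≤_ (sym (dyadic-rescale Q m r)) (sym centred) (nat-≤ lower′)) ,
    ℚP.*-cancelʳ-<-nonNeg (nat N) (subst₂ ℚ._<_ (sym centred) (sym rescaleRHS) (nat-< upper′))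
    where
    M = m + suc (k + k)
    r = suc (k + k)
    T = 2 ^ r
    N = 2 ^ M
    B = 2 * k * N
    instance
      N-pos : ℚ.Positive (nat N)
      N-pos = ℚP.normalize-pos N 1 {{_}} {{m^n≢0 2 M}}
      N-nonNeg : ℚ.NonNegative (nat N)
      N-nonNeg = ℚP.pos⇒nonNeg (nat N)
    B≤ : B ≤ 2 * SD
    B≤ = ≤-trans (m≤n+m B (Q * T)) lower
    centred : (1ℚ ℚ.+ 1ℚ) ℚ.* (dyadic SD M ℚ.- nat k) ℚ.* nat N ≡ nat (2 * SD ∸ B)
    centred = centred-rescale SD M k B≤
    rescaleRHS : (dyadic Q m ℚ.+ dyadic 1 m) ℚ.* nat N ≡ nat ((Q + 1) * T)
    rescaleRHS = begin
        (dyadic Q m ℚ.+ dyadic 1 m) ℚ.* nat N               ≡⟨ ℚP.*-distribʳ-+ (nat N) (dyadic Q m) (dyadic 1 m) ⟩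
        dyadic Q m ℚ.* nat N ℚ.+ dyadic 1 m ℚ.* nat N       ≡⟨ cong₂ ℚ._+_ (dyadic-rescale Q m r) (dyadic-rescale 1 m r) ⟩
        nat (Q * T) ℚ.+ nat (1 * T)                         ≡⟨ nat-+ (Q * T) (1 * T) ⟨
        nat (Q * T + 1 * T)                                 ≡⟨ cong nat (*-distribʳ-+ T Q 1) ⟨
        nat ((Q + 1) * T)                                   ∎
      where open ≡-Reasoning
    L+B : 2 * SD ∸ B + B ≡ 2 * SD
    L+B = m∸n+n≡m B≤
    lower′ : Q * T ≤ 2 * SD ∸ B
    lower′ = +-cancelʳ-≤ B (Q * T) _ (subst (Q * T + B ≤_) (sym L+B) lower)
    upper′ : 2 * SD ∸ B < (Q + 1) * T
    upper′ = +-cancelʳ-< B _ ((Q + 1) * T) (subst (_< (Q + 1) * T + B) (sym L+B) upper)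

lastIndex : ∀ {k} → 1 ≤ k → Σ (Fin k) (λ ℓ → suc (toℕ ℓ) ≡ k)
lastIndex {suc k'} _ = fromℕ k' , cong suc (FinP.toℕ-fromℕ k')

diameter-between : ∀ n m (E : Edges n m) → Connected E → (s t : Fin n) → (k : ℕ) → 1 ≤ k →
  (dec : ∀ (b : Vec Bool m) → Dec (Reach E (lookup b) s t)) →
  (D : Vec Bool (m + suc (k + k)) → ℕ) →
  (∀ w → IsDiameter (G'edges E s t k) (weightOf w) (D w)) →
  let open Averages E s t dec k in
  ∀ g c a b → (low g c a b ≤ D (g ++ (c ∷ (a ++ b)))) × (D (g ++ (c ∷ (a ++ b))) ≤ low g c a b + excess g c a b)
diameter-between n m E conn s t k 1≤k dec D diam g c a b with lastIndex 1≤k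
... | ℓ , ℓ-last = Ends.diameter≥ ℓ ℓ-last _ (diam _) , Upper.diameter≤ conn _ (diam _)
  where open Weighted n m E s t k dec g c a b

-- The theorem, with K = 10.
mainTheorem8 : ∃[ K ] (∀ (n m : ℕ) (E : Edges n m) → Simple E → Connected E → 1 ≤ m →
    (s t : Fin n) → s ≢ t →
    (k : ℕ) → 1 ≤ k → K * m ≤ k →
    (dec : ∀ (b : Vec Bool m) → Dec (Reach E (lookup b) s t)) →
    (D : Vec Bool (m + suc (k + k)) → ℕ) →
    (∀ w → IsDiameter (G'edges E s t k) (weightOf w) (D w)) →
    (disconnProb E s t dec ℚ.≤ (ℚ.1ℚ ℚ.+ ℚ.1ℚ) ℚ.* (expectation (m + suc (k + k)) D ℚ.- dyadic k 0))
    × ((ℚ.1ℚ ℚ.+ ℚ.1ℚ) ℚ.* (expectation (m + suc (k + k)) D ℚ.- dyadic k 0)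
        ℚ.< disconnProb E s t dec ℚ.+ dyadic 1 m))
mainTheorem8 = 10 , λ n m E _ conn 1≤m s t _ k 1≤k 10m≤k dec D diam →
  let open Averages E s t dec k
      between = diameter-between n m E conn s t k 1≤k dec D diam
      (lower , upper) = sum-bounds 1≤m 10m≤k D (λ g c a b → proj₁ (between g c a b))
                                               (λ g c a b → proj₂ (between g c a b))
  in Dyadic.fromScaled m k separating (sum (L.map D (allVecs M))) lower upper
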